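{- Let $\sigma\in\mathfrak{S}_n$ and let $R=R(\sigma)$. Then $\sigma$ is the unique preimage of $R$ under Patience Sorting (i.e. $R(\tau)=R$ implies $\tau=\sigma$ for $\tau\in\mathfrak{S}_n$) if and only if $\sigma\in S_n(3\mathrm{ - }\bar{1}\mathrm{ - }42,\,3\mathrm{ - }\bar{1}\mathrm{ - }24)$.
   Context: Patience Sorting: given $\sigma=\sigma_1\cdots\sigma_n\in\mathfrak{S}_n$, process $\sigma_1,\dots,\sigma_n$ in order, maintaining a left-to-right sequence of piles; $\sigma_1$ starts the first pile; each subsequent card is placed on top of the leftmost pile whose current top card is larger than it, and if no such pile exists it starts a new pile to the right. $R(\sigma)$ is the resulting sequence of piles. $S_n(\pi,\pi')$ is the set of permutations in $\mathfrak{S}_n$ avoiding both $\pi$ and $\pi'$. $\sigma$ contains $3\mathrm{ - }\bar{1}\mathrm{ - }42$ if there are indices $i<j<n$ with $\sigma_{j+1}<\sigma_i<\sigma_j$ and no $k$ with $i<k<j$, $\sigma_k<\sigma_{j+1}$. $\sigma$ contains $3\mathrm{ - }\bar{1}\mathrm{ - }24$ if there are indices $i<j<n$ with $\sigma_j<\sigma_i<\sigma_{j+1}$ and no $k$ with $i<k<j$, $\sigma_k<\sigma_j$. Avoiding means not containing. -}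

module Defs where

open import Data.Nat using (ℕ; suc)
open import Data.Fin using (Fin; toℕ; _<_; _<?_)
open import Data.Vec using (Vec; lookup; toList)
open import Data.List using (List; []; _∷_; foldl)
open import Data.Product using (Σ; _×_; Σ-syntax)
open import Relation.Nullary using (¬_; yes; no)
open import Relation.Binary.PropositionalEquality using (_≡_)

-- A permutation σ ∈ 𝔖ₙ in one-line notation σ₁⋯σₙ, with positions and values
-- in Fin n (i.e. {0,…,n-1} instead of {1,…,n}; order-isomorphic relabelling).
IsPerm : {n : ℕ} → Vec (Fin n) n → Set
IsPerm {n} σ = (i j : Fin n) → lookup σ i ≡ lookup σ j → i ≡ j

-- Piles: left-to-right list of piles; each pile is a list whose head is its top card.
Piles : ℕ → Set
Piles n = List (List (Fin n))

place : {n : ℕ} → Fin n → Piles n → Piles n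
place x [] = (x ∷ []) ∷ []
place x ([] ∷ ps) = [] ∷ place x ps   -- empty piles never occur
place x ((t ∷ p) ∷ ps) with x <? t
... | yes _ = (x ∷ t ∷ p) ∷ ps
... | no _  = (t ∷ p) ∷ place x ps

R : {n : ℕ} → Vec (Fin n) n → Piles n
R σ = foldl (λ ps x → place x ps) [] (toList σ)

Contains3b142 : {n : ℕ} → Vec (Fin n) n → Set
Contains3b142 {n} σ =
  Σ[ i ∈ Fin n ] Σ[ j ∈ Fin n ] Σ[ j' ∈ Fin n ]
    (i < j) × (toℕ j' ≡ suc (toℕ j)) ×
    (lookup σ j' < lookup σ i) × (lookup σ i < lookup σ j) ×
    ((k : Fin n) → i < k → k < j → ¬ (lookup σ k < lookup σ j'))

Contains3b124 : {n : ℕ} → Vec (Fin n) n → Set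
Contains3b124 {n} σ =
  Σ[ i ∈ Fin n ] Σ[ j ∈ Fin n ] Σ[ j' ∈ Fin n ]
    (i < j) × (toℕ j' ≡ suc (toℕ j)) ×
    (lookup σ j < lookup σ i) × (lookup σ i < lookup σ j') ×
    ((k : Fin n) → i < k → k < j → ¬ (lookup σ k < lookup σ j))

Avoids : {n : ℕ} → Vec (Fin n) n → Set
Avoids σ = ¬ Contains3b142 σ × ¬ Contains3b124 σ

UniquePreimage : {n : ℕ} → Vec (Fin n) n → Set
UniquePreimage {n} σ = (τ : Vec (Fin n) n) → IsPerm τ → R τ ≡ R σ → τ ≡ σ

module Submission where

-- Deal the cards of σ one at a time and call position j swappable if, just before σ_j is dealt,
-- some visible top card lies strictly between σ_j and σ_{j+1}. Then σ_j and σ_{j+1} land on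
-- different piles whichever comes first, so exchanging them gives a second preimage of R(σ).
-- Conversely, comparing two preimages of the same piles from their last cards backwards always
-- reaches a swappable position of σ. It remains to see that σ has a swappable position exactly
-- when it contains 3-1̄-42 or 3-1̄-24. For an occurrence σ_i, σ_j, σ_{j+1}, some card between
-- σ_j and σ_{j+1} stays visible from σ_i up to time j, because nothing dealt in between lies
-- below both. Conversely, let σ_i be the visible witness of a swap at j; if σ_i does not start an
-- occurrence, a card σ_{k+1} < σ_i ≤ σ_k with i ≤ k < j covers a card lying between them, so
-- k is swappable and we descend.

open import Defs
open import Data.Nat as ℕ using (ℕ; zero; suc; _<_; _≤_; z≤n; s≤s; s≤s⁻¹)
open import Data.Nat.Induction using (<-rec)
import Data.Nat.Properties as ℕP
open import Data.Fin as F using (Fin; _<?_; toℕ; fromℕ<)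
import Data.Fin.Properties as FP
open import Data.List using (List; []; _∷_; foldl)
open import Data.Vec using (Vec; []; _∷_; lookup; tabulate; toList)
open import Data.Vec.Properties using (lookup∘tabulate; tabulate∘lookup; tabulate-cong)
open import Data.List.Properties using (∷-injective; ∷-injectiveʳ)
open import Data.List.Relation.Unary.All as All using (All; []; _∷_)
open import Data.List.Relation.Unary.Any using (here; there)
open import Data.List.Membership.Propositional using (_∈_; _∉_)
open import Data.Product using (Σ; _×_; _,_; Σ-syntax; proj₂; map₁; map₂; uncurry)
open import Data.Sum as Sum using (_⊎_; inj₁; inj₂)
open import Data.Empty using (⊥)
open import Data.Unit using (⊤; tt)
open import Relation.Nullary using (¬_; yes; no; contradiction)
open import Relation.Unary using (Decidable)
open import Relation.Binary.PropositionalEquality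
open import Function using (_∘′_; id)

stays-off⊎switches-on : {P : ℕ → Set} → Decidable P → {i : ℕ} → ¬ P i → ∀ b → i ≤ b →
  (∀ k → i ≤ k → k ≤ b → ¬ P k) ⊎ Σ[ k ∈ ℕ ] i ≤ k × k < b × ¬ P k × P (suc k)
stays-off⊎switches-on P? ¬Pi zero z≤n = inj₁ λ { .zero z≤n z≤n → ¬Pi }
stays-off⊎switches-on {P} P? ¬Pi (suc b) i≤sb with ℕP.m≤n⇒m<n∨m≡n i≤sb
... | inj₂ refl = inj₁ λ k i≤k k≤i → subst (¬_ ∘′ P) (ℕP.≤-antisym i≤k k≤i) ¬Pi
... | inj₁ i<sb with stays-off⊎switches-on P? ¬Pi b (s≤s⁻¹ i<sb) | P? (suc b)
...   | inj₂ (k , i≤k , k<b , ¬Pk , Psk) | _ = inj₂ (k , i≤k , ℕP.m<n⇒m<1+n k<b , ¬Pk , Psk)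
...   | inj₁ off | yes Psb =
  inj₂ (b , s≤s⁻¹ i<sb , ℕP.n<1+n b , off b (s≤s⁻¹ i<sb) ℕP.≤-refl , Psb)
...   | inj₁ off | no ¬Psb = inj₁ λ k i≤k k≤sb →
  Sum.[ (λ k<sb → off k i≤k (s≤s⁻¹ k<sb)) , (λ { refl → ¬Psb }) ]′
    (ℕP.m≤n⇒m<n∨m≡n k≤sb)

swapAdj : ℕ → ℕ → ℕ
swapAdj j m with m ℕ.≟ j | m ℕ.≟ suc j
... | yes _ | _ = suc j
... | no _ | yes _ = j
... | no _ | no _ = m

swapAdj-j : ∀ j → swapAdj j j ≡ suc j
swapAdj-j j with j ℕ.≟ j
... | yes _ = refl
... | no j≢j = contradiction refl j≢j

swapAdj-suc : ∀ j → swapAdj j (suc j) ≡ j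
swapAdj-suc j with suc j ℕ.≟ j | suc j ℕ.≟ suc j
... | yes sj≡j | _ = contradiction sj≡j (ℕP.<⇒≢ (ℕP.n<1+n j) ∘′ sym)
... | no _ | yes _ = refl
... | no _ | no sj≢sj = contradiction refl sj≢sj

swapAdj-other : ∀ j m → m ≢ j → m ≢ suc j → swapAdj j m ≡ m
swapAdj-other j m m≢j m≢sj with m ℕ.≟ j | m ℕ.≟ suc j
... | yes m≡j | _ = contradiction m≡j m≢j
... | no _ | yes m≡sj = contradiction m≡sj m≢sj
... | no _ | no _ = refl

swapAdj-involutive : ∀ j m → swapAdj j (swapAdj j m) ≡ m
swapAdj-involutive j m with m ℕ.≟ j | m ℕ.≟ suc j
... | yes refl | _ = swapAdj-suc j
... | no _ | yes refl = swapAdj-j j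
... | no m≢j | no m≢sj = swapAdj-other j m m≢j m≢sj

swapAdj-< : ∀ {j m N} → suc j < N → m < N → swapAdj j m < N
swapAdj-< {j} {m} sj<N m<N with m ℕ.≟ j | m ℕ.≟ suc j
... | yes _ | _ = sj<N
... | no _ | yes _ = ℕP.<-trans (ℕP.n<1+n j) sj<N
... | no _ | no _ = m<N

-- A vector read as a sequence indexed by ℕ; past its end the junk default d is returned.
at : {A : Set} {N : ℕ} → A → Vec A N → ℕ → A
at d [] _ = d
at d (x ∷ _) zero = x
at d (_ ∷ xs) (suc m) = at d xs m

at-toℕ : {A : Set} {N : ℕ} (d : A) (xs : Vec A N) (i : Fin N) → at d xs (toℕ i) ≡ lookup xs i
at-toℕ _ (_ ∷ _) F.zero = refl
at-toℕ d (_ ∷ xs) (F.suc i) = at-toℕ d xs i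

at-fromℕ< : {A : Set} {N m : ℕ} (d : A) (xs : Vec A N) (m<N : m < N) →
            at d xs m ≡ lookup xs (fromℕ< m<N)
at-fromℕ< d xs m<N = trans (cong (at d xs) (sym (FP.toℕ-fromℕ< m<N))) (at-toℕ d xs (fromℕ< m<N))

at-tabulate : {A : Set} {N m : ℕ} (d : A) (g : ℕ → A) → m < N →
              at d (tabulate {n = N} (g ∘′ toℕ)) m ≡ g m
at-tabulate {N = suc _} {zero} d g _ = refl
at-tabulate {N = suc _} {suc m} d g m<N = at-tabulate d (g ∘′ suc) (s≤s⁻¹ m<N)

module _ {n : ℕ} where

  tops : Piles n → List (Fin n)
  tops [] = []
  tops ([] ∷ ps) = tops ps
  tops ((t ∷ _) ∷ ps) = t ∷ tops ps

  WellFormed : Piles n → Set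
  WellFormed [] = ⊤
  WellFormed ([] ∷ _) = ⊥
  WellFormed ((s ∷ _) ∷ ps) = All (s F.<_) (tops ps) × WellFormed ps

  Between : Fin n → Fin n → Fin n → Set
  Between a b t = (a F.< t × t F.< b) ⊎ (b F.< t × t F.< a)

  ≮∧≢⇒> : {x s : Fin n} → ¬ (x F.< s) → s ≢ x → s F.< x
  ≮∧≢⇒> x≮s s≢x = FP.≤∧≢⇒< (ℕP.≮⇒≥ x≮s) s≢x

  place-< : {x s : Fin n} {p : List (Fin n)} {ps : Piles n} →
            x F.< s → place x ((s ∷ p) ∷ ps) ≡ (x ∷ s ∷ p) ∷ ps
  place-< {x} {s} x<s with x <? s
  ... | yes _ = refl
  ... | no x≮s = contradiction x<s x≮s

  place-≮ : {x s : Fin n} {p : List (Fin n)} {ps : Piles n} →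
            ¬ (x F.< s) → place x ((s ∷ p) ∷ ps) ≡ (s ∷ p) ∷ place x ps
  place-≮ {x} {s} x≮s with x <? s
  ... | yes x<s = contradiction x<s x≮s
  ... | no _ = refl

  ∈-tops-place : (x : Fin n) (C : Piles n) → x ∈ tops (place x C)
  ∈-tops-place x [] = here refl
  ∈-tops-place x ([] ∷ ps) = ∈-tops-place x ps
  ∈-tops-place x ((t ∷ _) ∷ ps) with x <? t
  ... | yes _ = here refl
  ... | no _ = there (∈-tops-place x ps)

  ∈-tops-place⁻ : {u : Fin n} (x : Fin n) (C : Piles n) →
                  u ∈ tops (place x C) → u ≡ x ⊎ u ∈ tops C
  ∈-tops-place⁻ x [] (here u≡x) = inj₁ u≡x
  ∈-tops-place⁻ x ([] ∷ ps) u∈ = ∈-tops-place⁻ x ps u∈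
  ∈-tops-place⁻ x ((t ∷ _) ∷ ps) u∈ with x <? t | u∈
  ... | yes _ | here u≡x = inj₁ u≡x
  ... | yes _ | there u∈′ = inj₂ (there u∈′)
  ... | no _ | here u≡t = inj₂ (here u≡t)
  ... | no _ | there u∈′ = Sum.map₂ there (∈-tops-place⁻ x ps u∈′)

  ∈-tops-place⁺ : {u : Fin n} (x : Fin n) (C : Piles n) →
                  u ∈ tops C → u ∈ tops (place x C) ⊎ x F.< u
  ∈-tops-place⁺ x ([] ∷ ps) u∈ = ∈-tops-place⁺ x ps u∈
  ∈-tops-place⁺ x ((t ∷ _) ∷ ps) u∈ with x <? t | u∈
  ... | yes x<t | here refl = inj₂ x<t
  ... | yes _ | there u∈′ = inj₁ (there u∈′)
  ... | no _ | here refl = inj₁ (here refl)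
  ... | no _ | there u∈′ = Sum.map₁ there (∈-tops-place⁺ x ps u∈′)

  All<-tops-place⁻ : {s x : Fin n} (C : Piles n) → s F.< x →
                     All (s F.<_) (tops (place x C)) → All (s F.<_) (tops C)
  All<-tops-place⁻ {x = x} C s<x s<tops = All.tabulate λ u∈ →
    Sum.[ All.lookup s<tops , FP.<-trans s<x ]′ (∈-tops-place⁺ x C u∈)

  wellFormed-place : (x : Fin n) (C : Piles n) → WellFormed C → x ∉ tops C →
                     WellFormed (place x C)
  wellFormed-place x [] _ _ = [] , tt
  wellFormed-place x ((s ∷ p) ∷ ps) (s<ps , wf) x∉ with x <? s
  ... | yes x<s = All.map (FP.<-trans x<s) s<ps , wf
  ... | no x≮s = All.tabulate s<placed , wellFormed-place x ps wf (x∉ ∘′ there)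
    where
      s<placed : ∀ {u} → u ∈ tops (place x ps) → s F.< u
      s<placed u∈ = Sum.[ (λ { refl → ≮∧≢⇒> x≮s (x∉ ∘′ here ∘′ sym) }) , All.lookup s<ps ]′
        (∈-tops-place⁻ x ps u∈)

  ∈-tops-rest : {s t : Fin n} {p : List (Fin n)} {ps : Piles n} →
                t ∈ tops ((s ∷ p) ∷ ps) → t ≢ s → t ∈ tops ps
  ∈-tops-rest (here t≡s) t≢s = contradiction t≡s t≢s
  ∈-tops-rest (there t∈) _ = t∈

  ≮-first-top : {s t : Fin n} {p : List (Fin n)} {ps : Piles n} →
                WellFormed ((s ∷ p) ∷ ps) → t ∈ tops ((s ∷ p) ∷ ps) → ¬ (t F.< s)
  ≮-first-top _ (here refl) = FP.<-irrefl refl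
  ≮-first-top (s<ps , _) (there t∈) t<s = FP.<-asym t<s (All.lookup s<ps t∈)

  place-comm-< : {a b t : Fin n} (C : Piles n) → WellFormed C → t ∈ tops C →
                 a F.< t → t F.< b → place b (place a C) ≡ place a (place b C)
  place-comm-< {a} {b} ((s ∷ p) ∷ ps) wf t∈ a<t t<b with a <? s | b <? s
  ... | yes _ | yes b<s = contradiction (FP.<-trans t<b b<s) (≮-first-top {p = p} {ps} wf t∈)
  ... | yes a<s | no _ = trans (place-≮ (FP.<-asym (FP.<-trans a<t t<b))) (sym (place-< a<s))
  ... | no a≮s | yes b<s = contradiction (FP.<-trans (FP.<-trans a<t t<b) b<s) a≮s
  ... | no a≮s | no b≮s = begin
    place b ((s ∷ p) ∷ place a ps)  ≡⟨ place-≮ b≮s ⟩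
    (s ∷ p) ∷ place b (place a ps)  ≡⟨ cong ((s ∷ p) ∷_) (place-comm-< ps (proj₂ wf) t∈ps a<t t<b) ⟩
    (s ∷ p) ∷ place a (place b ps)  ≡⟨ place-≮ a≮s ⟨
    place a ((s ∷ p) ∷ place b ps)  ∎
    where
      open ≡-Reasoning
      t∈ps = ∈-tops-rest {p = p} {ps} t∈ λ { refl → a≮s a<t }

  place-comm : {a b t : Fin n} (C : Piles n) → WellFormed C → t ∈ tops C → Between a b t →
               place b (place a C) ≡ place a (place b C)
  place-comm C wf t∈ (inj₁ (a<t , t<b)) = place-comm-< C wf t∈ a<t t<b
  place-comm C wf t∈ (inj₂ (b<t , t<a)) = sym (place-comm-< C wf t∈ b<t t<a)

  between-top-of-place-comm : {x y : Fin n} (C : Piles n) → x ≢ y → x ∉ tops C → y ∉ tops C →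
    place x (place y C) ≡ place y (place x C) → Σ[ t ∈ Fin n ] t ∈ tops C × Between x y t
  between-top-of-place-comm {x} {y} [] x≢y _ _ eq with x <? y | y <? x | eq
  ... | yes x<y | yes y<x | _ = contradiction y<x (FP.<-asym x<y)
  ... | no _ | no _ | refl = contradiction refl x≢y
  between-top-of-place-comm ([] ∷ ps) x≢y x∉ y∉ eq =
    between-top-of-place-comm ps x≢y x∉ y∉ (∷-injectiveʳ eq)
  between-top-of-place-comm {x} {y} ((s ∷ p) ∷ ps) x≢y x∉ y∉ eq with x <? s | y <? s | eq
  ... | yes x<s | no y≮s | _ = s , here refl , inj₁ (x<s , ≮∧≢⇒> y≮s (y∉ ∘′ here ∘′ sym))
  ... | no x≮s | yes y<s | _ = s , here refl , inj₂ (y<s , ≮∧≢⇒> x≮s (x∉ ∘′ here ∘′ sym))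
  ... | no x≮s | no y≮s | e =
    map₂ (map₁ there)
      (between-top-of-place-comm ps x≢y (x∉ ∘′ there) (y∉ ∘′ there)
        (∷-injectiveʳ (trans (sym (place-≮ x≮s)) (trans e (place-≮ y≮s)))))
  ... | yes _ | yes _ | e with x <? y | y <? x | e
  ...   | yes x<y | yes y<x | _ = contradiction y<x (FP.<-asym x<y)
  ...   | yes _ | no _ | ()
  ...   | no _ | yes _ | ()
  ...   | no _ | no _ | refl = contradiction refl x≢y

  unplace : Fin n → Piles n → Piles n
  unplace y [] = []
  unplace y ([] ∷ ps) = [] ∷ unplace y ps
  unplace y ((s ∷ p) ∷ ps) with y F.≟ s | p
  ... | yes _ | [] = ps
  ... | yes _ | p′ = p′ ∷ ps
  ... | no _ | _ = (s ∷ p) ∷ unplace y ps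

  unplace-place : (y : Fin n) (C : Piles n) → y ∉ tops C → unplace y (place y C) ≡ C
  unplace-place y [] _ with y F.≟ y
  ... | yes _ = refl
  ... | no y≢y = contradiction refl y≢y
  unplace-place y ([] ∷ ps) y∉ = cong ([] ∷_) (unplace-place y ps y∉)
  unplace-place y ((s ∷ p) ∷ ps) y∉ with y <? s
  ... | yes _ with y F.≟ y
  ...   | yes _ = refl
  ...   | no y≢y = contradiction refl y≢y
  unplace-place y ((s ∷ p) ∷ ps) y∉ | no _ with y F.≟ s
  ...   | yes y≡s = contradiction (here y≡s) y∉
  ...   | no _ = cong ((s ∷ p) ∷_) (unplace-place y ps (y∉ ∘′ there))

  place-injective : (y : Fin n) {A B : Piles n} → y ∉ tops A → y ∉ tops B →
                    place y A ≡ place y B → A ≡ B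
  place-injective y {A} {B} y∉A y∉B eq = begin
    A                      ≡⟨ unplace-place y A y∉A ⟨
    unplace y (place y A)  ≡⟨ cong (unplace y) eq ⟩
    unplace y (place y B)  ≡⟨ unplace-place y B y∉B ⟩
    B                      ∎
    where open ≡-Reasoning

  -- Placing a visible card again would show it twice, which well-formed piles cannot.
  ∉-tops-of-wellFormed-place : (y : Fin n) (C : Piles n) → WellFormed (place y C) → y ∉ tops C
  ∉-tops-of-wellFormed-place y ((s ∷ p) ∷ ps) wf y∈ with y <? s | wf | y∈
  ... | yes y<s | _ | here refl = FP.<-irrefl refl y<s
  ... | yes _ | y<ps , _ | there y∈ps = FP.<-irrefl refl (All.lookup y<ps y∈ps)
  ... | no _ | s<ps , _ | here refl = FP.<-irrefl refl (All.lookup s<ps (∈-tops-place y ps))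
  ... | no _ | _ , wf′ | there y∈ps = ∉-tops-of-wellFormed-place y ps wf′ y∈ps

  place-split : {x y : Fin n} (C₀ C′ : Piles n) → x ≢ y → WellFormed C₀ → WellFormed C′ →
    place y C₀ ≡ place x C′ →
    Σ[ C ∈ Piles n ] C₀ ≡ place x C × C′ ≡ place y C × WellFormed C
  place-split {x} [] C′ x≢y _ _ eq with subst (λ C → x ∈ tops C) (sym eq) (∈-tops-place x C′)
  ... | here x≡y = contradiction x≡y x≢y
  place-split {y = y} C₀@(_ ∷ _) [] x≢y _ _ eq
    with subst (λ C → y ∈ tops C) eq (∈-tops-place y C₀)
  ... | here y≡x = contradiction (sym y≡x) x≢y
  place-split {x} {y} ((s ∷ p) ∷ ps) ((s′ ∷ p′) ∷ ps′) x≢y (s<ps , wf) (s′<ps′ , wf′) eq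
    with y <? s | x <? s′ | eq
  ... | yes _ | yes _ | refl = contradiction refl x≢y
  ... | yes y<s | no _ | refl =
    (s ∷ p) ∷ ps′ , sym (place-≮ (FP.<-asym s<x)) , sym (place-< y<s) ,
    All<-tops-place⁻ ps′ s<x s<ps , wf′
    where s<x = All.lookup s<ps (∈-tops-place x ps′)
  ... | no _ | yes x<s′ | refl =
    (s′ ∷ p′) ∷ ps , sym (place-< x<s′) , sym (place-≮ (FP.<-asym s′<y)) ,
    All<-tops-place⁻ ps s′<y s′<ps′ , wf
    where s′<y = All.lookup s′<ps′ (∈-tops-place y ps)
  ... | no y≮s | no x≮s′ | e with ∷-injective e
  ...   | refl , e′ with place-split ps ps′ x≢y wf wf′ e′
  ...     | C , refl , refl , wfC =
    (s ∷ p) ∷ C , sym (place-≮ (FP.<-asym s<x)) , sym (place-≮ y≮s) ,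
    All<-tops-place⁻ C s<x s<ps , wfC
    where s<x = All.lookup s<ps (∈-tops-place x C)

  -- Since t stays visible, x must have landed on a pile to the left of t.
  top-between-of-place : {x t : Fin n} (C : Piles n) → WellFormed C → t ∈ tops C →
    t ∈ tops (place x C) → x F.< t → Σ[ u ∈ Fin n ] u ∈ tops C × x F.< u × u F.< t
  top-between-of-place {x} ((s ∷ p) ∷ ps) (s<ps , wf) t∈ t∈′ x<t with x <? s | t∈ | t∈′
  ... | yes _ | _ | here t≡x = contradiction (sym t≡x) (FP.<⇒≢ x<t)
  ... | yes x<s | _ | there t∈ps = s , here refl , x<s , All.lookup s<ps t∈ps
  ... | no x≮s | here refl | _ = contradiction x<t x≮s
  ... | no x≮s | there _ | here refl = contradiction x<t x≮s
  ... | no _ | there t∈ps | there t∈′ =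
    map₂ (map₁ there) (top-between-of-place ps wf t∈ps t∈′ x<t)

module _ {n : ℕ} where

  dealFrom : Piles n → (ℕ → Fin n) → ℕ → Piles n
  dealFrom C v zero = C
  dealFrom C v (suc m) = place (v m) (dealFrom C v m)

  deal : (ℕ → Fin n) → ℕ → Piles n
  deal = dealFrom []

  Distinct : (ℕ → Fin n) → ℕ → Set
  Distinct v N = ∀ {a b} → a < N → b < N → v a ≡ v b → a ≡ b

  distinct-≤ : {v : ℕ → Fin n} {N N′ : ℕ} → N′ ≤ N → Distinct v N → Distinct v N′
  distinct-≤ N′≤N dist a< b< = dist (ℕP.<-≤-trans a< N′≤N) (ℕP.<-≤-trans b< N′≤N)

  ∈-tops-deal : {u : Fin n} (v : ℕ → Fin n) (m : ℕ) → u ∈ tops (deal v m) →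
                Σ[ k ∈ ℕ ] k < m × v k ≡ u
  ∈-tops-deal v (suc m) u∈ with ∈-tops-place⁻ (v m) (deal v m) u∈
  ... | inj₁ refl = m , ℕP.n<1+n m , refl
  ... | inj₂ u∈′ with ∈-tops-deal v m u∈′
  ...   | k , k<m , refl = k , ℕP.m<n⇒m<1+n k<m , refl

  ∉-tops-deal : {v : ℕ → Fin n} {N m k : ℕ} → Distinct v N → m ≤ k → k < N →
                v k ∉ tops (deal v m)
  ∉-tops-deal {v} {m = m} dist m≤k k<N vk∈ with ∈-tops-deal v m vk∈
  ... | l , l<m , vl≡vk = ℕP.<-irrefl (dist (ℕP.<-trans (ℕP.<-≤-trans l<m m≤k) k<N) k<N vl≡vk)
                                      (ℕP.<-≤-trans l<m m≤k)

  wellFormed-deal : {v : ℕ → Fin n} {N : ℕ} → Distinct v N → ∀ m → m ≤ N →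
                    WellFormed (deal v m)
  wellFormed-deal dist zero _ = tt
  wellFormed-deal {v} dist (suc m) m<N =
    wellFormed-place (v m) (deal v m) (wellFormed-deal dist m (ℕP.<⇒≤ m<N))
      (∉-tops-deal dist ℕP.≤-refl m<N)

  ∈-tops-deal-earlier : {v : ℕ → Fin n} {N i m : ℕ} → Distinct v N → i < m →
    ∀ m′ → m ≤ m′ → m′ ≤ N → v i ∈ tops (deal v m′) → v i ∈ tops (deal v m)
  ∈-tops-deal-earlier dist i<m m′ m≤m′ m′≤N vi∈ with ℕP.m≤n⇒m<n∨m≡n m≤m′
  ... | inj₂ refl = vi∈
  ∈-tops-deal-earlier {v} dist i<m (suc m′) _ m′<N vi∈ | inj₁ m<sm′
    with ∈-tops-place⁻ (v m′) (deal v m′) vi∈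
  ... | inj₂ vi∈′ = ∈-tops-deal-earlier dist i<m m′ (s≤s⁻¹ m<sm′) (ℕP.<⇒≤ m′<N) vi∈′
  ... | inj₁ vi≡vm′ = contradiction (dist (ℕP.<-trans i<m′ m′<N) m′<N vi≡vm′) (ℕP.<⇒≢ i<m′)
    where i<m′ = ℕP.<-≤-trans i<m (s≤s⁻¹ m<sm′)

  Swappable : (ℕ → Fin n) → ℕ → ℕ → Set
  Swappable v N j = suc j < N × Σ[ t ∈ Fin n ] t ∈ tops (deal v j) × Between (v j) (v (suc j)) t

  -- Occurrences of 3-1̄-42 and 3-1̄-24 at positions i < j < j + 1, merged into one notion.
  Pattern : (ℕ → Fin n) → ℕ → ℕ → Set
  Pattern v N j = Σ[ i ∈ ℕ ] i < j × suc j < N × Between (v j) (v (suc j)) (v i) ×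
    (∀ k → i < k → k < j → ¬ (v k F.< v j × v k F.< v (suc j)))

  swappable-≤ : {v : ℕ → Fin n} {N N′ j : ℕ} → N ≤ N′ → Swappable v N j → Swappable v N′ j
  swappable-≤ N≤N′ (sj<N , t-between) = ℕP.<-≤-trans sj<N N≤N′ , t-between

  <-between : {a b t c : Fin n} → Between a b t → c F.< a → c F.< b → c F.< t
  <-between (inj₁ (a<t , _)) c<a _ = FP.<-trans c<a a<t
  <-between (inj₂ (b<t , _)) _ c<b = FP.<-trans c<b b<t

  between-below : {a b t c : Fin n} → Between a b t → c F.< t → c ≢ a → c ≢ b →
                  ¬ (c F.< a × c F.< b) → Between a b c
  between-below (inj₁ (_ , t<b)) c<t c≢a _ ¬c<ab =
    inj₁ (≮∧≢⇒> (λ c<a → ¬c<ab (c<a , c<b)) (c≢a ∘′ sym) , c<b)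
    where c<b = FP.<-trans c<t t<b
  between-below (inj₂ (_ , t<a)) c<t _ c≢b ¬c<ab =
    inj₂ (≮∧≢⇒> (λ c<b → ¬c<ab (c<a , c<b)) (c≢b ∘′ sym) , c<a)
    where c<a = FP.<-trans c<t t<a

  -- A visible card between v j and v (suc j) can only be covered by another such card, since
  -- nothing dealt after v i is below both.
  pattern⇒swappable : {v : ℕ → Fin n} {N j : ℕ} → Distinct v N → Pattern v N j → Swappable v N j
  pattern⇒swappable {v} {j = j} dist (i , i<j , sj<N , vi-between , gap) =
    sj<N , visible i<j ℕP.≤-refl
    where
      j<N = ℕP.<-trans (ℕP.n<1+n j) sj<N
      visible : ∀ {m} → i < m → m ≤ j →
                Σ[ u ∈ Fin n ] u ∈ tops (deal v m) × Between (v j) (v (suc j)) u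
      visible {suc m} (s≤s i≤m) m<j with ℕP.m≤n⇒m<n∨m≡n i≤m
      ... | inj₂ refl = v i , ∈-tops-place (v i) (deal v i) , vi-between
      ... | inj₁ i<m with visible i<m (ℕP.<⇒≤ m<j)
      ...   | u , u∈ , u-between with ∈-tops-place⁺ (v m) (deal v m) u∈
      ...     | inj₁ u∈′ = u , u∈′ , u-between
      ...     | inj₂ vm<u = v m , ∈-tops-place (v m) (deal v m) ,
        between-below u-between vm<u
          (ℕP.<⇒≢ m<j ∘′ dist (ℕP.<-trans m<j j<N) j<N)
          (ℕP.<⇒≢ (ℕP.m<n⇒m<1+n m<j) ∘′ dist (ℕP.<-trans m<j j<N) sj<N)
          (gap m i<m m<j)

  swappable-of-covering : {v : ℕ → Fin n} {N i k : ℕ} → Distinct v N → suc k < N →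
    v i ∈ tops (deal v (suc k)) → v i ∈ tops (deal v (suc (suc k))) →
    ¬ (v k F.< v i) → v (suc k) F.< v i → Swappable v N k
  swappable-of-covering {v} {i = i} {k} dist sk<N vi∈ vi∈′ vk≮vi vsk<vi
    with top-between-of-place (deal v (suc k)) (wellFormed-deal dist (suc k) (ℕP.<⇒≤ sk<N))
           vi∈ vi∈′ vsk<vi
  ... | u , u∈ , vsk<u , u<vi =
    sk<N , u , u∈′ , inj₂ (vsk<u , ℕP.<-≤-trans u<vi (ℕP.≮⇒≥ vk≮vi))
    where
      u∈′ : u ∈ tops (deal v k)
      u∈′ = Sum.[ (λ u≡vk → contradiction (subst (F._< v i) u≡vk u<vi) vk≮vi) , id ]′
              (∈-tops-place⁻ (v k) (deal v k) u∈)

  -- Write the visible witness as v i. Either nothing dealt after v i is below it, which gives a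
  -- pattern, or some v (suc k) < v i ≤ v k with i ≤ k covers a card that makes k swappable.
  swappable⇒pattern⊎swappable : {v : ℕ → Fin n} {N j : ℕ} → Distinct v N → Swappable v N j →
    Pattern v N j ⊎ Σ[ j′ ∈ ℕ ] j′ < j × Swappable v N j′
  swappable⇒pattern⊎swappable {v} {j = j} dist (sj<N , t , t∈ , t-between) with ∈-tops-deal v j t∈
  ... | i , i<j@(s≤s i≤j₀) , refl
    with stays-off⊎switches-on (λ k → v k F.<? v i) (FP.<-irrefl refl) _ i≤j₀
  ...   | inj₁ off = inj₁ (i , i<j , sj<N , t-between , λ k i<k k<j vk<both →
            off k (ℕP.<⇒≤ i<k) (s≤s⁻¹ k<j) (uncurry (<-between t-between) vk<both))
  ...   | inj₂ (k , i≤k , k<j₀ , vk≮vi , vsk<vi) =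
    inj₂ (k , ℕP.m<n⇒m<1+n k<j₀ ,
          swappable-of-covering dist (ℕP.<-trans (s≤s k<j₀) j<N)
            (vi∈ (s≤s i≤k) (ℕP.<⇒≤ (s≤s k<j₀))) (vi∈ (ℕP.m<n⇒m<1+n (s≤s i≤k)) (s≤s k<j₀))
            vk≮vi vsk<vi)
    where
      j<N = ℕP.<-trans (ℕP.n<1+n j) sj<N
      vi∈ : ∀ {m} → i < m → m ≤ j → v i ∈ tops (deal v m)
      vi∈ i<m m≤j = ∈-tops-deal-earlier dist i<m j m≤j (ℕP.<⇒≤ j<N) t∈

  swappable⇒pattern : {v : ℕ → Fin n} {N : ℕ} → Distinct v N → ∀ j → Swappable v N j →
                      Σ[ j′ ∈ ℕ ] Pattern v N j′
  swappable⇒pattern {v} {N} dist = <-rec Goal step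
    where
      Goal : ℕ → Set
      Goal j = Swappable v N j → Σ[ j′ ∈ ℕ ] Pattern v N j′
      step : ∀ j → (∀ {j′} → j′ < j → Goal j′) → Goal j
      step j rec swap = Sum.[ (j ,_) , (λ (_ , j′<j , swap′) → rec j′<j swap′) ]′
                          (swappable⇒pattern⊎swappable dist swap)

  -- Peel cards off the end of the deal until y meets its own position K; there the placements
  -- of v K and v (suc K) commute.
  swappable-of-place : {v : ℕ → Fin n} {y : Fin n} (M : ℕ) (C₀ : Piles n) → Distinct v (suc M) →
    y ≢ v M → WellFormed C₀ → place y C₀ ≡ deal v (suc M) → Σ[ j ∈ ℕ ] Swappable v (suc M) j
  swappable-of-place {y = y} zero C₀ _ y≢v₀ _ eq
    with subst (λ C → y ∈ tops C) eq (∈-tops-place y C₀)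
  ... | here y≡v₀ = contradiction y≡v₀ y≢v₀
  swappable-of-place {v} {y} (suc K) C₀ dist y≢ wf₀ eq
    with place-split C₀ (deal v (suc K)) (y≢ ∘′ sym) wf₀
           (wellFormed-deal dist (suc K) (ℕP.n≤1+n _)) eq
  ... | C , refl , deal≡ , wfC with y F.≟ v K
  ...   | no y≢vK = map₂ (swappable-≤ (ℕP.n≤1+n _))
                      (swappable-of-place K C (distinct-≤ (ℕP.n≤1+n _) dist) y≢vK wfC (sym deal≡))
  ...   | yes refl with place-injective (v K) {C} {deal v K}
                          (∉-tops-of-wellFormed-place (v K) C
                             (subst WellFormed deal≡ (wellFormed-deal dist (suc K) (ℕP.n≤1+n _))))
                          (∉-tops-deal dist ℕP.≤-refl (ℕP.m<n⇒m<1+n (ℕP.n<1+n K)))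
                          (sym deal≡)
  ...     | refl with between-top-of-place-comm (deal v K) (y≢ ∘′ sym)
                        (∉-tops-deal dist (ℕP.n≤1+n K) ℕP.≤-refl)
                        (∉-tops-deal dist ℕP.≤-refl (ℕP.m<n⇒m<1+n (ℕP.n<1+n K))) (sym eq)
  ...       | t , t∈ , t-between = K , ℕP.≤-refl , t , t∈ , Sum.swap t-between

  swappable-of-same-deal : {v w : ℕ → Fin n} (N : ℕ) → Distinct v N → Distinct w N →
    deal v N ≡ deal w N → ∀ {m} → m < N → v m ≢ w m → Σ[ j ∈ ℕ ] Swappable v N j
  swappable-of-same-deal {v} {w} (suc M) dv dw eq {m} m<sM vm≢wm with v M F.≟ w M
  ... | no vM≢wM =
    swappable-of-place M (deal w M) dv (vM≢wM ∘′ sym) (wellFormed-deal dw M (ℕP.n≤1+n M)) (sym eq)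
  ... | yes vM≡wM = map₂ (swappable-≤ (ℕP.n≤1+n M))
    (swappable-of-same-deal M (distinct-≤ (ℕP.n≤1+n M) dv) (distinct-≤ (ℕP.n≤1+n M) dw)
       prefix≡ m<M vm≢wm)
    where
      m<M = ℕP.≤∧≢⇒< (s≤s⁻¹ m<sM) λ { refl → vm≢wm vM≡wM }
      prefix≡ = place-injective (v M) (∉-tops-deal dv ℕP.≤-refl ℕP.≤-refl)
        (subst (λ c → c ∉ tops (deal w M)) (sym vM≡wM) (∉-tops-deal dw ℕP.≤-refl ℕP.≤-refl))
        (trans eq (cong (λ c → place c (deal w M)) (sym vM≡wM)))

  deal-cong : {v w : ℕ → Fin n} {a : ℕ} → ∀ b → a ≤ b → deal w a ≡ deal v a →
              (∀ l → a ≤ l → l < b → w l ≡ v l) → deal w b ≡ deal v b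
  deal-cong zero z≤n eq _ = eq
  deal-cong (suc b) a≤sb eq agree with ℕP.m≤n⇒m<n∨m≡n a≤sb
  ... | inj₂ refl = eq
  ... | inj₁ a<sb = cong₂ place (agree b (s≤s⁻¹ a<sb) ℕP.≤-refl)
                      (deal-cong b (s≤s⁻¹ a<sb) eq λ l a≤l l<b → agree l a≤l (ℕP.m<n⇒m<1+n l<b))

  deal-swapAdj : {v : ℕ → Fin n} {N j : ℕ} → Distinct v N → Swappable v N j →
                 deal (v ∘′ swapAdj j) N ≡ deal v N
  deal-swapAdj {v} {N} {j} dist (sj<N , t , t∈ , t-between) =
    deal-cong N sj<N swapped-prefix λ l ssj≤l _ → cong v
      (swapAdj-other j l (ℕP.<⇒≢ (ℕP.<-trans (ℕP.n<1+n j) ssj≤l) ∘′ sym) (ℕP.<⇒≢ ssj≤l ∘′ sym))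
    where
      open ≡-Reasoning
      j<N = ℕP.<-trans (ℕP.n<1+n j) sj<N
      prefix : deal (v ∘′ swapAdj j) j ≡ deal v j
      prefix = deal-cong j z≤n refl λ l _ l<j →
        cong v (swapAdj-other j l (ℕP.<⇒≢ l<j) (ℕP.<⇒≢ (ℕP.m<n⇒m<1+n l<j)))
      swapped-prefix : deal (v ∘′ swapAdj j) (suc (suc j)) ≡ deal v (suc (suc j))
      swapped-prefix = begin
        place (v (swapAdj j (suc j))) (place (v (swapAdj j j)) (deal (v ∘′ swapAdj j) j))
          ≡⟨ cong₂ (λ a b → place (v a) (place (v b) (deal (v ∘′ swapAdj j) j)))
                   (swapAdj-suc j) (swapAdj-j j) ⟩
        place (v j) (place (v (suc j)) (deal (v ∘′ swapAdj j) j))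
          ≡⟨ cong (λ C → place (v j) (place (v (suc j)) C)) prefix ⟩
        place (v j) (place (v (suc j)) (deal v j))
          ≡⟨ place-comm (deal v j) (wellFormed-deal dist j (ℕP.<⇒≤ j<N)) t∈ t-between ⟨
        place (v (suc j)) (place (v j) (deal v j))
          ∎

module _ {n : ℕ} where

  dealFrom-suc : (C : Piles n) (v : ℕ → Fin n) (m : ℕ) →
                 dealFrom C v (suc m) ≡ dealFrom (place (v zero) C) (v ∘′ suc) m
  dealFrom-suc C v zero = refl
  dealFrom-suc C v (suc m) = cong (place (v (suc m))) (dealFrom-suc C v m)

  foldl-place : {N : ℕ} (d : Fin n) (C : Piles n) (xs : Vec (Fin n) N) →
                foldl (λ ps x → place x ps) C (toList xs) ≡ dealFrom C (at d xs) N
  foldl-place d C [] = refl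
  foldl-place {suc N} d C (x ∷ xs) =
    trans (foldl-place d (place x C) xs) (sym (dealFrom-suc C (at d (x ∷ xs)) N))

  R-deal : (d : Fin n) (σ : Vec (Fin n) n) → R σ ≡ deal (at d σ) n
  R-deal d = foldl-place d []

  distinct-at : (d : Fin n) (σ : Vec (Fin n) n) → IsPerm σ → Distinct (at d σ) n
  distinct-at d σ σ-perm {a} {b} a<n b<n eq = begin
    a                    ≡⟨ FP.toℕ-fromℕ< a<n ⟨
    toℕ (fromℕ< a<n)     ≡⟨ cong toℕ (σ-perm _ _ lookups≡) ⟩
    toℕ (fromℕ< b<n)     ≡⟨ FP.toℕ-fromℕ< b<n ⟩
    b                    ∎
    where
      open ≡-Reasoning
      lookups≡ = trans (sym (at-fromℕ< d σ a<n)) (trans eq (at-fromℕ< d σ b<n))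

module _ {n : ℕ} (d : Fin n) (σ : Vec (Fin n) n) where

  private
    v : ℕ → Fin n
    v = at d σ

  contains⇒pattern : Contains3b142 σ ⊎ Contains3b124 σ → Σ[ j ∈ ℕ ] Pattern v n j
  contains⇒pattern = Sum.[ pattern42 , pattern24 ]′
    where
      vsj≡ : {j j′ : Fin n} → toℕ j′ ≡ suc (toℕ j) → v (suc (toℕ j)) ≡ lookup σ j′
      vsj≡ {j′ = j′} j′≡sj = trans (cong v (sym j′≡sj)) (at-toℕ d σ j′)
      ↓< : {a b : Fin n} {c c′ : ℕ} → v c ≡ a → v c′ ≡ b → a F.< b → v c F.< v c′
      ↓< p q = subst₂ F._<_ (sym p) (sym q)
      gap-ℕ : {i j b : Fin n} → ((k : Fin n) → i F.< k → k F.< j → ¬ (lookup σ k F.< b)) →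
              ∀ k → toℕ i < k → k < toℕ j → ¬ (v k F.< b)
      gap-ℕ {i} {j} {b} gap k i<k k<j vk<b =
        gap (fromℕ< k<n) (subst (toℕ i <_) (sym k≡) i<k) (subst (_< toℕ j) (sym k≡) k<j)
            (subst (F._< b) (at-fromℕ< d σ k<n) vk<b)
        where
          k<n = ℕP.<-trans k<j (FP.toℕ<n j)
          k≡ = FP.toℕ-fromℕ< k<n
      pattern42 : Contains3b142 σ → Σ[ j ∈ ℕ ] Pattern v n j
      pattern42 (i , j , j′ , i<j , j′≡sj , σj′<σi , σi<σj , gap) =
        toℕ j , toℕ i , i<j , subst (_< n) j′≡sj (FP.toℕ<n j′) ,
        inj₂ (↓< (vsj≡ j′≡sj) (at-toℕ d σ i) σj′<σi ,
              ↓< (at-toℕ d σ i) (at-toℕ d σ j) σi<σj) ,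
        λ k i<k k<j (_ , vk<vsj) → gap-ℕ gap k i<k k<j (subst (v k F.<_) (vsj≡ j′≡sj) vk<vsj)
      pattern24 : Contains3b124 σ → Σ[ j ∈ ℕ ] Pattern v n j
      pattern24 (i , j , j′ , i<j , j′≡sj , σj<σi , σi<σj′ , gap) =
        toℕ j , toℕ i , i<j , subst (_< n) j′≡sj (FP.toℕ<n j′) ,
        inj₁ (↓< (at-toℕ d σ j) (at-toℕ d σ i) σj<σi ,
              ↓< (at-toℕ d σ i) (vsj≡ j′≡sj) σi<σj′) ,
        λ k i<k k<j (vk<vj , _) → gap-ℕ gap k i<k k<j (subst (v k F.<_) (at-toℕ d σ j) vk<vj)

  pattern⇒contains : {j : ℕ} → Pattern v n j → Contains3b142 σ ⊎ Contains3b124 σ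
  pattern⇒contains {j} (i , i<j , sj<n , between , gap) =
    Sum.[ occurrence24 , occurrence42 ]′ between
    where
      j<n = ℕP.<-trans (ℕP.n<1+n j) sj<n
      i<n = ℕP.<-trans i<j j<n
      ↑< : {a b : ℕ} (a<n : a < n) (b<n : b < n) → v a F.< v b →
           lookup σ (fromℕ< a<n) F.< lookup σ (fromℕ< b<n)
      ↑< a<n b<n = subst₂ F._<_ (at-fromℕ< d σ a<n) (at-fromℕ< d σ b<n)
      iF<jF : fromℕ< i<n F.< fromℕ< j<n
      iF<jF = subst₂ _<_ (sym (FP.toℕ-fromℕ< i<n)) (sym (FP.toℕ-fromℕ< j<n)) i<j
      sjF≡ : toℕ (fromℕ< sj<n) ≡ suc (toℕ (fromℕ< j<n))
      sjF≡ = trans (FP.toℕ-fromℕ< sj<n) (cong suc (sym (FP.toℕ-fromℕ< j<n)))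
      gap-Fin : {c : ℕ} (c<n : c < n) → (∀ k → i < k → k < j → ¬ (v k F.< v c)) →
                (k : Fin n) → fromℕ< i<n F.< k → k F.< fromℕ< j<n →
                ¬ (lookup σ k F.< lookup σ (fromℕ< c<n))
      gap-Fin c<n gap′ k i<k k<j σk<σc =
        gap′ (toℕ k) (subst (_< toℕ k) (FP.toℕ-fromℕ< i<n) i<k)
             (subst (toℕ k <_) (FP.toℕ-fromℕ< j<n) k<j)
             (subst₂ F._<_ (sym (at-toℕ d σ k)) (sym (at-fromℕ< d σ c<n)) σk<σc)
      occurrence24 : v j F.< v i × v i F.< v (suc j) → Contains3b142 σ ⊎ Contains3b124 σ
      occurrence24 (vj<vi , vi<vsj) =
        inj₂ (fromℕ< i<n , fromℕ< j<n , fromℕ< sj<n , iF<jF , sjF≡ ,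
              ↑< j<n i<n vj<vi , ↑< i<n sj<n vi<vsj ,
              gap-Fin j<n λ k i<k k<j vk<vj →
                gap k i<k k<j (vk<vj , FP.<-trans vk<vj (FP.<-trans vj<vi vi<vsj)))
      occurrence42 : v (suc j) F.< v i × v i F.< v j → Contains3b142 σ ⊎ Contains3b124 σ
      occurrence42 (vsj<vi , vi<vj) =
        inj₁ (fromℕ< i<n , fromℕ< j<n , fromℕ< sj<n , iF<jF , sjF≡ ,
              ↑< sj<n i<n vsj<vi , ↑< i<n j<n vi<vj ,
              gap-Fin sj<n λ k i<k k<j vk<vsj →
                gap k i<k k<j (FP.<-trans vk<vsj (FP.<-trans vsj<vi vi<vj) , vk<vsj))

module _ {n : ℕ} (d : Fin n) {σ : Vec (Fin n) n} (σ-perm : IsPerm σ) where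

  private
    v : ℕ → Fin n
    v = at d σ

    dist : Distinct v n
    dist = distinct-at d σ σ-perm

  swappable⇒¬unique : {j : ℕ} → Swappable v n j → ¬ UniquePreimage σ
  swappable⇒¬unique {j} swap@(sj<n , _) unique = τ≢σ (unique τ τ-perm Rτ≡Rσ)
    where
      open ≡-Reasoning
      j<n = ℕP.<-trans (ℕP.n<1+n j) sj<n
      τ : Vec (Fin n) n
      τ = tabulate (v ∘′ swapAdj j ∘′ toℕ)
      τ-at : ∀ {m} → m < n → at d τ m ≡ v (swapAdj j m)
      τ-at = at-tabulate d (v ∘′ swapAdj j)
      τ-perm : IsPerm τ
      τ-perm a b τa≡τb = FP.toℕ-injective (begin
        toℕ a                          ≡⟨ swapAdj-involutive j (toℕ a) ⟨
        swapAdj j (swapAdj j (toℕ a))  ≡⟨ cong (swapAdj j) (dist (swapAdj-< sj<n (FP.toℕ<n a))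
                                            (swapAdj-< sj<n (FP.toℕ<n b)) v-eq) ⟩
        swapAdj j (swapAdj j (toℕ b))  ≡⟨ swapAdj-involutive j (toℕ b) ⟩
        toℕ b                          ∎)
        where
          v-eq = trans (sym (lookup∘tabulate _ a)) (trans τa≡τb (lookup∘tabulate _ b))
      Rτ≡Rσ : R τ ≡ R σ
      Rτ≡Rσ = begin
        R τ                      ≡⟨ R-deal d τ ⟩
        deal (at d τ) n          ≡⟨ deal-cong n z≤n refl (λ _ _ l<n → τ-at l<n) ⟩
        deal (v ∘′ swapAdj j) n  ≡⟨ deal-swapAdj dist swap ⟩
        deal v n                 ≡⟨ R-deal d σ ⟨
        R σ                      ∎
      τ≢σ : τ ≢ σ
      τ≢σ τ≡σ = ℕP.<⇒≢ (ℕP.n<1+n j) (sym (dist sj<n j<n (begin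
        v (suc j)          ≡⟨ cong v (swapAdj-j j) ⟨
        v (swapAdj j j)    ≡⟨ τ-at j<n ⟨
        at d τ j           ≡⟨ cong (λ xs → at d xs j) τ≡σ ⟩
        v j                ∎)))

  unique⇒avoids : UniquePreimage σ → Avoids σ
  unique⇒avoids unique = ¬occurrence ∘′ inj₁ , ¬occurrence ∘′ inj₂
    where
      ¬occurrence : ¬ (Contains3b142 σ ⊎ Contains3b124 σ)
      ¬occurrence c =
        swappable⇒¬unique (pattern⇒swappable dist (proj₂ (contains⇒pattern d σ c))) unique

  avoids⇒unique : Avoids σ → UniquePreimage σ
  avoids⇒unique (¬42 , ¬24) τ τ-perm Rτ≡Rσ with FP.all? (λ i → lookup τ i F.≟ lookup σ i)
  ... | yes τ≗σ = trans (sym (tabulate∘lookup τ)) (trans (tabulate-cong τ≗σ) (tabulate∘lookup σ))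
  ... | no τ≉σ with FP.¬∀⟶∃¬ n _ (λ i → lookup τ i F.≟ lookup σ i) τ≉σ
  ...   | i , τi≢σi = contradiction (pattern⇒contains d σ (proj₂ found)) Sum.[ ¬42 , ¬24 ]′
    where
      same-deal : deal v n ≡ deal (at d τ) n
      same-deal = trans (sym (R-deal d σ)) (trans (sym Rτ≡Rσ) (R-deal d τ))
      differ : v (toℕ i) ≢ at d τ (toℕ i)
      differ vi≡τi = τi≢σi (trans (sym (at-toℕ d τ i)) (trans (sym vi≡τi) (at-toℕ d σ i)))
      found = swappable⇒pattern dist _
        (proj₂ (swappable-of-same-deal n dist (distinct-at d τ τ-perm) same-deal (FP.toℕ<n i) differ))

mainTheorem3 : (n : ℕ) → (σ : Vec (Fin n) n) → IsPerm σ →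
    (UniquePreimage σ → Avoids σ) × (Avoids σ → UniquePreimage σ)
mainTheorem3 zero [] _ = (λ _ → (λ { (() , _) }) , (λ { (() , _) })) , λ { _ [] _ _ → refl }
mainTheorem3 (suc n) σ σ-perm = unique⇒avoids F.zero σ-perm , avoids⇒unique F.zero σ-perm
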